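{- Let $\pi$ be the decorated permutation of a positroid on $[n]$, let $U$ be the set of unblocked positions of $\pi$, and let $\emptyset\ne C\subseteq U$. If the $2$-coloured positions of $\pi$ are $\{i_1,\dots,i_k\}$, then the $2$-coloured positions of $\overrightarrow{\rho_{A(C)}}(\pi)$ are $\{\min C,i_1,\dots,i_k\}$.
   Context: A decorated permutation on $[n]$ is a permutation $\pi$ of $[n]$ with a colouring $c:[n]\to\{1,2\}$ such that $c(j)=1$ if $\pi(j)<j$ and $c(j)=2$ if $\pi(j)>j$ (fixed points may have either colour); position $j$ is $c(j)$-coloured. Decorated permutations are in bijection with positroids on $[n]$; for a rank $k$ positroid exactly $k$ positions are $2$-coloured. Permutations are multiplied as functions. A position $j$ is unblocked if $c(j)=1$ and every $j'>j$ with $c(j')=1$ satisfies $\pi(j')>\pi(j)$. For nonempty $C\subseteq U$, $T(C)=\{t_1<\dots<t_s\}$ is the maximal set of $2$-coloured positions with $t_s<\min C$ and $\pi(\max C)<\pi(t_1)<\dots<\pi(t_s)$, chosen greedily (each $t_{r}$ is the smallest $2$-coloured position greater than $t_{r-1}$ and less than $\min C$ with $\pi(t_r)>\pi(t_{r-1})$, where $\pi(t_0):=\pi(\max C)$, $t_0:=0$). $A(C)=[n]\setminus(C\sqcup T(C))$. For $A\subseteq[n]$ with $[n]\setminus A=\{b_1<\dots<b_\ell\}$, $\sigma=(b_\ell\ \cdots\ b_1)$ (i.e. $\sigma(b_i)=b_{i-1}$, $\sigma(b_1)=b_\ell$), and $\overrightarrow{\rho_A}(\pi)=\pi\sigma$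 with colouring determined by $\pi\sigma(j)$ vs $j$ at non-fixed points, fixed points in $A$ keeping their colour from $\pi$, and fixed points not in $A$ coloured $2$. -}

module Defs where

open import Data.Nat using (ℕ; zero; suc)
open import Data.Bool using (Bool; true; false; if_then_else_; _∧_; _∨_; not)
open import Data.Fin using (Fin; zero; suc; _<_)
open import Data.Fin.Properties using (_<?_; _≟_)
open import Data.Fin.Permutation using (Permutation′; _⟨$⟩ʳ_)
open import Data.Fin.Subset using (Subset; _∈_)
open import Data.Fin.Subset.Properties using (_∈?_)
open import Data.List using (List; []; _∷_; filter; last)
open import Data.Bool.ListAction using (any)
open import Data.Vec using (Vec)
import Data.Vec
open import Data.List.Base using (allFin)
open import Data.Maybe using (Maybe; just; nothing)
import Data.Maybe as Maybe
open import Data.Product using (_×_; Σ; _,_)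
open import Relation.Nullary.Decidable using (⌊_⌋; does; yes; no)
open import Data.Bool.Properties using () renaming (_≟_ to _B≟_)
open import Relation.Binary.PropositionalEquality using (_≡_)

data Colour : Set where
  one two : Colour

isTwo : Colour → Bool
isTwo one = false
isTwo two = true

-- A decorated permutation on [n] (positions are Fin n, i.e. [n] shifted to 0..n-1;
-- only the order matters).  Permutations compose as functions.
record DecoratedPerm (n : ℕ) : Set where
  field
    perm   : Permutation′ n
    colour : Fin n → Colour
    below  : ∀ j → perm ⟨$⟩ʳ j < j → colour j ≡ one
    above  : ∀ j → j < perm ⟨$⟩ʳ j → colour j ≡ two
open DecoratedPerm public

module _ {n : ℕ} (D : DecoratedPerm n) where

  private
    π : Fin n → Fin n
    π j = perm D ⟨$⟩ʳ j
    c : Fin n → Colour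
    c = colour D

  Unblocked : Fin n → Set
  Unblocked j = (c j ≡ one) × (∀ j' → j < j' → c j' ≡ one → π j < π j')

  -- Greedy construction of T(C), given m = min C and M = max C:
  -- scan positions in increasing order below m, taking a 2-coloured
  -- position whenever its image exceeds the current image (initially π M).
  greedyT : Fin n → Fin n → List (Fin n) → List (Fin n)
  greedyT m cur [] = []
  greedyT m cur (j ∷ js) =
    if ⌊ j <? m ⌋ ∧ isTwo (c j) ∧ ⌊ cur <? π j ⌋
    then j ∷ greedyT m (π j) js
    else greedyT m cur js

  Tset : (m M : Fin n) → List (Fin n)
  Tset m M = greedyT m (π M) (allFin n)

  -- membership in C ⊔ T(C) = [n] ∖ A(C)
  inB : Subset n → (m M : Fin n) → Fin n → Bool
  inB C m M j = ⌊ j ∈? C ⌋ ∨ any (λ t → ⌊ t ≟ j ⌋) (Tset m M)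

  prevIn : Fin n → List (Fin n) → Maybe (Fin n)
  prevIn j [] = nothing
  prevIn j (a ∷ []) = nothing
  prevIn j (a ∷ b ∷ rest) = if ⌊ b ≟ j ⌋ then just a else prevIn j (b ∷ rest)

  -- σ = (b_ℓ ⋯ b_1) for {b_1 < ⋯ < b_ℓ} = [n] ∖ A(C) = C ⊔ T(C)
  sigma : Subset n → (m M : Fin n) → Fin n → Fin n
  sigma C m M j =
    if inB C m M j
    then Maybe.fromMaybe (Maybe.fromMaybe j (last bs)) (prevIn j bs)
    else j
    where
    bs : List (Fin n)
    bs = filter (λ x → inB C m M x B≟ true) (allFin n)

  -- colouring of ρ_{A(C)}(π) = π σ
  rhoColour : Subset n → (m M : Fin n) → Fin n → Colour
  rhoColour C m M j with π (sigma C m M j) <? j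
  ... | yes _ = one
  ... | no _ with j <? π (sigma C m M j)
  ...   | yes _ = two
  ...   | no _ = if inB C m M j then two else c j

firstIn : ∀ {n} → Subset n → Maybe (Fin n)
firstIn Data.Vec.[] = nothing
firstIn (true Data.Vec.∷ p) = just zero
firstIn (false Data.Vec.∷ p) = Maybe.map suc (firstIn p)

lastIn : ∀ {n} → Subset n → Maybe (Fin n)
lastIn Data.Vec.[] = nothing
lastIn (b Data.Vec.∷ p) with lastIn p
... | just x = just (suc x)
... | nothing = if b then just zero else nothing

{-# OPTIONS --safe #-}
module Submission where

-- Write B = C ⊔ T(C); σ cycles B downwards and fixes everything else, so positions outside B keep
-- their colour.  Above min C the set B meets only C, whose positions are 1-coloured and unblocked;
-- there σ j is the previous element of C, so π (σ j) < π j ≤ j and j stays 1-coloured.  At or below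
-- min C, σ j is the previous element of T(C), or max C when j = min B, and the greedy choice of T(C)
-- gives π p ≤ v := π (σ j) for every 2-coloured p < j.  Since π moves 1-coloured positions weakly
-- down and also sends max C ≥ j to at most v, injectivity of π forces j ≤ v (otherwise 0, …, v and
-- max C would all land in 0, …, v), so j becomes 2-coloured.

open import Defs
open import Data.Bool using (Bool; true; false; if_then_else_)
open import Data.Bool.ListAction using (any)
open import Data.Bool.Properties using (T-≡) renaming (_≟_ to _B≟_)
open import Data.Fin using (Fin; zero; suc; toℕ; inject≤; lower; _≤_; _<_)
open import Data.Fin.Permutation using (_⟨$⟩ʳ_)
open import Data.Fin.Properties
  using (_≟_; _<?_; ≤-antisym; toℕ<n; toℕ-inject≤; inject≤-injective; lower-injective; injective⇒≤)
open import Data.Fin.Subset using (Subset; _∈_; _∉_)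
open import Data.Fin.Subset.Properties using (_∈?_)
open import Data.List using (List; []; _∷_; filter; last; allFin)
open import Data.List.Membership.Propositional using () renaming (_∈_ to _∈ₗ_)
open import Data.List.Membership.Propositional.Properties using (∈-filter⁺; ∈-filter⁻; ∈-allFin)
open import Data.List.Relation.Unary.All as All using ()
open import Data.List.Relation.Unary.AllPairs using (AllPairs; _∷_)
open import Data.List.Relation.Unary.AllPairs.Properties using (tabulate⁺-<; filter⁺)
open import Data.List.Relation.Unary.Any as Any using (here; there)
open import Data.List.Relation.Unary.Any.Properties using (any⁺; any⁻)
open import Data.Maybe as Maybe using (just; nothing)
open import Data.Nat using (ℕ; _+_; z≤n; s≤s)
import Data.Nat.Properties as ℕ
open import Data.Product using (_×_; _,_; proj₁; proj₂; ∃-syntax)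
open import Data.Sum using (_⊎_; inj₁; inj₂)
import Data.Vec as Vec
open import Function using (_∘_; Injection)
open import Function.Bundles using (_⇔_; mk⇔; Equivalence)
open import Function.Definitions using (Injective)
open import Function.Properties.Inverse using (↔⇒↣)
open import Relation.Nullary using (Dec; yes; no; contradiction)
open import Relation.Nullary.Decidable using (⌊_⌋; toWitness; fromWitness)
open import Relation.Binary.PropositionalEquality using (_≡_; _≢_; refl; sym; trans; cong; subst)

segment-closed-injection-reflects-≤ : ∀ {n} {f : Fin n → Fin n} {v q : Fin n} →
  Injective _≡_ _≡_ f → (∀ p → p ≤ v → f p ≤ v) → f q ≤ v → q ≤ v
segment-closed-injection-reflects-≤ {n} {f} {v} {q} f-injective closed fq≤v =
  ℕ.≮⇒≥ λ v<q → contradiction (injective⇒≤ (g-injective v<q)) ℕ.1+n≰n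
  where
  -- q followed by 0, …, v: 2 + v points that f injects into the 1 + v points 0, …, v.
  dom : Fin (2 + toℕ v) → Fin n
  dom zero    = q
  dom (suc i) = inject≤ i (toℕ<n v)
  dom-suc-≤ : ∀ i → dom (suc i) ≤ v
  dom-suc-≤ i = ℕ.≤-trans (ℕ.≤-reflexive (toℕ-inject≤ i _)) (ℕ.≤-pred (toℕ<n i))
  f-dom-≤ : ∀ i → f (dom i) ≤ v
  f-dom-≤ zero    = fq≤v
  f-dom-≤ (suc i) = closed _ (dom-suc-≤ i)
  g : Fin (2 + toℕ v) → Fin (1 + toℕ v)
  g i = lower (f (dom i)) (s≤s (f-dom-≤ i))
  dom-injective : v < q → Injective _≡_ _≡_ dom
  dom-injective _   {zero}  {zero}  _  = refl
  dom-injective v<q {zero}  {suc j} eq = contradiction (subst (_≤ v) (sym eq) (dom-suc-≤ j)) (ℕ.<⇒≱ v<q)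
  dom-injective v<q {suc i} {zero}  eq = contradiction (subst (_≤ v) eq (dom-suc-≤ i)) (ℕ.<⇒≱ v<q)
  dom-injective _   {suc i} {suc j} eq = cong suc (inject≤-injective _ _ i j eq)
  g-injective : v < q → Injective _≡_ _≡_ g
  g-injective v<q = dom-injective v<q ∘ f-injective ∘ lower-injective _ _

allFin-increasing : ∀ {n} → AllPairs _<_ (allFin n)
allFin-increasing = tabulate⁺-< (λ i<j → i<j)

last-maximum : ∀ {n} {w : Fin n} {L} → AllPairs _<_ L → w ∈ₗ L → (∀ {y} → y ∈ₗ L → y ≤ w) →
               last L ≡ just w
last-maximum {L = _ ∷ []}    _              (here refl) _       = refl
last-maximum {L = _ ∷ _ ∷ _} (a<rest ∷ _)  (here refl) maximum =
  contradiction (maximum (there (here refl))) (ℕ.<⇒≱ (All.head a<rest))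
last-maximum {L = _ ∷ _ ∷ _} (_ ∷ rest↑)   (there w∈)  maximum = last-maximum rest↑ w∈ (maximum ∘ there)

firstIn-minimum : ∀ {n} {C : Subset n} {m} → firstIn C ≡ just m → m ∈ C × (∀ {j} → j ∈ C → m ≤ j)
firstIn-minimum {C = true Vec.∷ _} refl = Vec.here , λ _ → z≤n
firstIn-minimum {C = false Vec.∷ C} eq with firstIn C in first
... | just _ with refl ← eq =
  let (m∈ , minimum) = firstIn-minimum first
  in Vec.there m∈ , λ { (Vec.there j∈) → s≤s (minimum j∈) }

lastIn-nothing : ∀ {n} {C : Subset n} → lastIn C ≡ nothing → ∀ {j} → j ∉ C
lastIn-nothing {C = b Vec.∷ C} eq j∈ with lastIn C in lst
lastIn-nothing {C = false Vec.∷ C} _ (Vec.there j∈) | nothing = lastIn-nothing lst j∈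

lastIn-maximum : ∀ {n} {C : Subset n} {M} → lastIn C ≡ just M → M ∈ C × (∀ {j} → j ∈ C → j ≤ M)
lastIn-maximum {C = b Vec.∷ C} eq with lastIn C in lst
lastIn-maximum {C = b Vec.∷ C} refl | just _ =
  let (M∈ , maximum) = lastIn-maximum lst
  in Vec.there M∈ , λ { Vec.here → z≤n ; (Vec.there j∈) → s≤s (maximum j∈) }
lastIn-maximum {C = true Vec.∷ C} refl | nothing =
  Vec.here , λ { Vec.here → z≤n ; (Vec.there j∈) → contradiction j∈ (lastIn-nothing lst) }

∈⇒any-≟ : ∀ {n} {j : Fin n} {L} → j ∈ₗ L → any (λ t → ⌊ t ≟ j ⌋) L ≡ true
∈⇒any-≟ j∈L = Equivalence.to T-≡ (any⁺ _ (Any.map (λ { refl → fromWitness refl }) j∈L))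

any-≟⇒∈ : ∀ {n} {j : Fin n} L → any (λ t → ⌊ t ≟ j ⌋) L ≡ true → j ∈ₗ L
any-≟⇒∈ {j = j} L found =
  Any.map (λ {t} t≟j → sym (toWitness {a? = t ≟ j} t≟j)) (any⁻ _ L (Equivalence.from T-≡ found))

if-true : ∀ {A : Set} {b} {x y : A} → b ≡ true → (if b then x else y) ≡ x
if-true refl = refl

if-false : ∀ {A : Set} {b} {x y : A} → b ≡ false → (if b then x else y) ≡ y
if-false refl = refl

one≢two : one ≢ two
one≢two ()

module _ {n : ℕ} (D : DecoratedPerm n) where

  private
    π : Fin n → Fin n
    π j = perm D ⟨$⟩ʳ j

  π-injective : Injective _≡_ _≡_ π
  π-injective = Injection.injective (↔⇒↣ (perm D))

  colour-one⇒π≤ : ∀ {j} → colour D j ≡ one → π j ≤ j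
  colour-one⇒π≤ {j} c≡one = ℕ.≮⇒≥ λ j<πj → one≢two (trans (sym c≡one) (above D j j<πj))

  twoColoured-bounded⇒≤ : ∀ {t v q : Fin n} → (∀ p → p < t → colour D p ≡ two → π p ≤ v) →
                          t ≤ q → π q ≤ v → t ≤ v
  twoColoured-bounded⇒≤ {t} {v} {q} bounded t≤q πq≤v = ℕ.≮⇒≥ λ v<t →
    ℕ.<⇒≱ v<t (ℕ.≤-trans t≤q (segment-closed-injection-reflects-≤ {q = q} π-injective (closed v<t) πq≤v))
    where
    closed : v < t → ∀ p → p ≤ v → π p ≤ v
    closed v<t p p≤v with colour D p in c
    ... | one = ℕ.≤-trans (colour-one⇒π≤ c) p≤v
    ... | two = bounded p (ℕ.≤-<-trans p≤v v<t) c

  module _ (m : Fin n) where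

    data GreedyStep (cur j : Fin n) (js : List (Fin n)) : List (Fin n) → Set where
      take : j < m → colour D j ≡ two → cur < π j → GreedyStep cur j js (j ∷ greedyT D m (π j) js)
      skip : (j < m → colour D j ≡ two → π j ≤ cur) → GreedyStep cur j js (greedyT D m cur js)

    greedyT-step : ∀ cur j js → GreedyStep cur j js (greedyT D m cur (j ∷ js))
    greedyT-step cur j js with j <? m | colour D j in c | cur <? π j
    ... | yes j<m | two | yes cur<πj = take j<m c cur<πj
    ... | yes _   | two | no cur≮πj  = skip λ _ _ → ℕ.≮⇒≥ cur≮πj
    ... | yes _   | one | _          = skip λ _ c≡two → contradiction (trans (sym c) c≡two) one≢two
    ... | no j≮m  | _   | _          = skip λ j<m → contradiction j<m j≮m

    greedyT-sound : ∀ {cur L x} → x ∈ₗ greedyT D m cur L →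
                    x ∈ₗ L × x < m × colour D x ≡ two × cur < π x
    greedyT-sound {cur} {j ∷ js} x∈ with greedyT D m cur (j ∷ js) | greedyT-step cur j js
    ... | _ | take j<m c cur<πj with x∈
    ...   | here refl = here refl , j<m , c , cur<πj
    ...   | there x∈′ =
      let (x∈js , x<m , cx , πj<πx) = greedyT-sound {π j} {js} x∈′
      in there x∈js , x<m , cx , ℕ.<-trans cur<πj πj<πx
    greedyT-sound {cur} {j ∷ js} x∈ | _ | skip _ =
      let (x∈js , rest) = greedyT-sound x∈ in there x∈js , rest

    greedyT-monotone : ∀ {cur L} → AllPairs _<_ L → ∀ {x y} →
                       x ∈ₗ greedyT D m cur L → y ∈ₗ greedyT D m cur L → x ≤ y → π x ≤ π y
    greedyT-monotone {cur} {j ∷ js} (j<js ∷ js↑) x∈ y∈ x≤y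
      with greedyT D m cur (j ∷ js) | greedyT-step cur j js
    ... | _ | take _ _ _ with x∈ | y∈
    ...   | here refl | here refl = ℕ.≤-refl
    ...   | here refl | there y∈′ = ℕ.<⇒≤ (proj₂ (proj₂ (proj₂ (greedyT-sound {π j} {js} y∈′))))
    ...   | there x∈′ | here refl =
      contradiction x≤y (ℕ.<⇒≱ (All.lookup j<js (proj₁ (greedyT-sound {π j} {js} x∈′))))
    ...   | there x∈′ | there y∈′ = greedyT-monotone js↑ x∈′ y∈′ x≤y
    greedyT-monotone (_ ∷ js↑) x∈ y∈ x≤y | _ | skip _ = greedyT-monotone js↑ x∈ y∈ x≤y

    greedyT-dominates : ∀ {cur L} → AllPairs _<_ L → ∀ {p} → p ∈ₗ L → p < m → colour D p ≡ two →
                        π p ≤ cur ⊎ ∃[ x ] (x ∈ₗ greedyT D m cur L × x ≤ p × π p ≤ π x)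
    greedyT-dominates {cur} {j ∷ js} (j<js ∷ js↑) p∈ p<m c
      with greedyT D m cur (j ∷ js) | greedyT-step cur j js | p∈
    ... | _ | take _ _ _ | here refl = inj₂ (j , here refl , ℕ.≤-refl , ℕ.≤-refl)
    ... | _ | take _ _ _ | there p∈′ with greedyT-dominates {π j} js↑ p∈′ p<m c
    ...   | inj₁ πp≤πj = inj₂ (j , here refl , ℕ.<⇒≤ (All.lookup j<js p∈′) , πp≤πj)
    ...   | inj₂ (x , x∈ , x≤p , πp≤πx) = inj₂ (x , there x∈ , x≤p , πp≤πx)
    greedyT-dominates _ _ p<m c | _ | skip πj≤cur | here refl = inj₁ (πj≤cur p<m c)
    greedyT-dominates (_ ∷ js↑) _ p<m c | _ | skip _ | there p∈′ = greedyT-dominates js↑ p∈′ p<m c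

  prevIn-just : ∀ {j x L} → AllPairs _<_ L → prevIn D j L ≡ just x →
                x ∈ₗ L × x < j × (∀ {y} → y ∈ₗ L → y < j → y ≤ x)
  prevIn-just {j} {L = a ∷ b ∷ rest} (a<bs ∷ bs↑) eq with b ≟ j
  prevIn-just {L = a ∷ b ∷ rest} (a<bs ∷ (b<rest ∷ _)) refl | yes refl =
    here refl , All.head a<bs , λ
      { (here refl)         _   → ℕ.≤-refl
      ; (there (here refl)) y<b → contradiction y<b (ℕ.<-irrefl refl)
      ; (there (there y∈))  y<b → contradiction y<b (ℕ.<-asym (All.lookup b<rest y∈))
      }
  prevIn-just {L = a ∷ b ∷ rest} (a<bs ∷ bs↑) eq | no _ =
    let (x∈ , x<j , maximal) = prevIn-just bs↑ eq
    in there x∈ , x<j , λ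
      { (here refl) _   → ℕ.<⇒≤ (All.lookup a<bs x∈)
      ; (there y∈)  y<j → maximal y∈ y<j
      }

  prevIn-nothing : ∀ {j L} → AllPairs _<_ L → j ∈ₗ L → prevIn D j L ≡ nothing →
                   ∀ {y} → y ∈ₗ L → j ≤ y
  prevIn-nothing {L = _ ∷ []} _ (here refl) _ (here refl) = ℕ.≤-refl
  prevIn-nothing {j} {L = a ∷ b ∷ rest} (a<bs ∷ bs↑) j∈ eq y∈ with b ≟ j | bs↑
  ... | no b≢j | b<rest ∷ _ with j∈ | y∈
  ...   | here refl | here refl = ℕ.≤-refl
  ...   | here refl | there y∈′ = ℕ.<⇒≤ (All.lookup a<bs y∈′)
  ...   | there (here refl) | _ = contradiction refl b≢j
  ...   | there (there j∈rest) | _ =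
    contradiction (prevIn-nothing bs↑ (there j∈rest) eq (here refl)) (ℕ.<⇒≱ (All.lookup b<rest j∈rest))

  module _ (C : Subset n) {m M : Fin n} (m-first : firstIn C ≡ just m) (M-last : lastIn C ≡ just M) where

    private
      T : List (Fin n)
      T = Tset D m M

      isB : Fin n → Bool
      isB = inB D C m M

      bs : List (Fin n)
      bs = filter (λ x → isB x B≟ true) (allFin n)

      σ : Fin n → Fin n
      σ = sigma D C m M

    m∈C : m ∈ C
    m∈C = proj₁ (firstIn-minimum m-first)

    m≤C : ∀ {j} → j ∈ C → m ≤ j
    m≤C = proj₂ (firstIn-minimum m-first)

    M∈C : M ∈ C
    M∈C = proj₁ (lastIn-maximum M-last)

    C≤M : ∀ {j} → j ∈ C → j ≤ M
    C≤M = proj₂ (lastIn-maximum M-last)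

    T<m : ∀ {x} → x ∈ₗ T → x < m
    T<m = proj₁ ∘ proj₂ ∘ greedyT-sound m {π M} {allFin n}

    T-two : ∀ {x} → x ∈ₗ T → colour D x ≡ two
    T-two = proj₁ ∘ proj₂ ∘ proj₂ ∘ greedyT-sound m {π M} {allFin n}

    πM<πT : ∀ {x} → x ∈ₗ T → π M < π x
    πM<πT = proj₂ ∘ proj₂ ∘ proj₂ ∘ greedyT-sound m {π M} {allFin n}

    inB⇒∈C⊎T : ∀ {x} → isB x ≡ true → x ∈ C ⊎ x ∈ₗ T
    inB⇒∈C⊎T {x} x∈B with x ∈? C
    ... | yes x∈C = inj₁ x∈C
    ... | no _    = inj₂ (any-≟⇒∈ T x∈B)

    ∈C⇒inB : ∀ {x} → x ∈ C → isB x ≡ true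
    ∈C⇒inB {x} x∈C with x ∈? C
    ... | yes _   = refl
    ... | no x∉C  = contradiction x∈C x∉C

    ∈T⇒inB : ∀ {x} → x ∈ₗ T → isB x ≡ true
    ∈T⇒inB {x} x∈T with x ∈? C
    ... | yes _ = refl
    ... | no _  = ∈⇒any-≟ x∈T

    bs-increasing : AllPairs _<_ bs
    bs-increasing = filter⁺ (λ x → isB x B≟ true) allFin-increasing

    inB⇒∈bs : ∀ {x} → isB x ≡ true → x ∈ₗ bs
    inB⇒∈bs = ∈-filter⁺ (λ x → isB x B≟ true) (∈-allFin _)

    ∈bs⇒∈C⊎T : ∀ {x} → x ∈ₗ bs → x ∈ C ⊎ x ∈ₗ T
    ∈bs⇒∈C⊎T = inB⇒∈C⊎T ∘ proj₂ ∘ ∈-filter⁻ (λ x → isB x B≟ true) {xs = allFin n}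

    ∈bs⇒≤M : ∀ {x} → x ∈ₗ bs → x ≤ M
    ∈bs⇒≤M x∈bs with ∈bs⇒∈C⊎T x∈bs
    ... | inj₁ x∈C = C≤M x∈C
    ... | inj₂ x∈T = ℕ.<⇒≤ (ℕ.<-≤-trans (T<m x∈T) (m≤C M∈C))

    ∈bs∧<m⇒∈T : ∀ {x} → x ∈ₗ bs → x < m → x ∈ₗ T
    ∈bs∧<m⇒∈T x∈bs x<m with ∈bs⇒∈C⊎T x∈bs
    ... | inj₁ x∈C = contradiction (m≤C x∈C) (ℕ.<⇒≱ x<m)
    ... | inj₂ x∈T = x∈T

    ∈bs∧≥m⇒∈C : ∀ {x} → x ∈ₗ bs → m ≤ x → x ∈ C
    ∈bs∧≥m⇒∈C x∈bs m≤x with ∈bs⇒∈C⊎T x∈bs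
    ... | inj₁ x∈C = x∈C
    ... | inj₂ x∈T = contradiction (T<m x∈T) (ℕ.≤⇒≯ m≤x)

    last-bs : last bs ≡ just M
    last-bs = last-maximum bs-increasing (inB⇒∈bs (∈C⇒inB M∈C)) ∈bs⇒≤M

    σ-outside : ∀ {j} → isB j ≡ false → σ j ≡ j
    σ-outside = if-false

    σ-prev : ∀ {j x} → isB j ≡ true → prevIn D j bs ≡ just x → σ j ≡ x
    σ-prev j∈B prev = trans (if-true j∈B) (cong (Maybe.fromMaybe _) prev)

    σ-first : ∀ {j} → isB j ≡ true → prevIn D j bs ≡ nothing → σ j ≡ M
    σ-first {j} j∈B prev =
      trans (if-true j∈B) (trans (cong (Maybe.fromMaybe _) prev) (cong (Maybe.fromMaybe j) last-bs))

    rhoColour-outside : ∀ {j} → isB j ≡ false → rhoColour D C m M j ≡ colour D j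
    rhoColour-outside {j} j∉B with π (σ j) <? j
    ... | yes πσj<j = sym (below D j (subst (λ s → π s < j) (σ-outside j∉B) πσj<j))
    ... | no _ with j <? π (σ j)
    ...   | yes j<πσj = sym (above D j (subst (λ s → j < π s) (σ-outside j∉B) j<πσj))
    ...   | no _      = if-false j∉B

    rhoColour-descent : ∀ {j} → π (σ j) < j → rhoColour D C m M j ≡ one
    rhoColour-descent {j} πσj<j with π (σ j) <? j
    ... | yes _     = refl
    ... | no πσj≮j = contradiction πσj<j πσj≮j

    rhoColour-weakExcedance : ∀ {j} → isB j ≡ true → j ≤ π (σ j) → rhoColour D C m M j ≡ two
    rhoColour-weakExcedance {j} j∈B j≤πσj with π (σ j) <? j
    ... | yes πσj<j = contradiction πσj<j (ℕ.≤⇒≯ j≤πσj)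
    ... | no _ with j <? π (σ j)
    ...   | yes _ = refl
    ...   | no _  = if-true j∈B

    T-bounded⇒≤ : ∀ {j v} → j ≤ m → π M ≤ v → (∀ {x} → x ∈ₗ T → x < j → π x ≤ v) → j ≤ v
    T-bounded⇒≤ {j} {v} j≤m πM≤v T-bounded = twoColoured-bounded⇒≤ bounded (ℕ.≤-trans j≤m (m≤C M∈C)) πM≤v
      where
      bounded : ∀ p → p < j → colour D p ≡ two → π p ≤ v
      bounded p p<j c with greedyT-dominates m allFin-increasing (∈-allFin p) (ℕ.<-≤-trans p<j j≤m) c
      ... | inj₁ πp≤πM                  = ℕ.≤-trans πp≤πM πM≤v
      ... | inj₂ (x , x∈T , x≤p , πp≤πx) = ℕ.≤-trans πp≤πx (T-bounded x∈T (ℕ.≤-<-trans x≤p p<j))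

    upTo-m⇒j≤πσj : ∀ {j} → isB j ≡ true → j ≤ m → j ≤ π (σ j)
    upTo-m⇒j≤πσj {j} j∈B j≤m = by-prev (prevIn D j bs) refl
      where
      -- not `with prevIn D j bs`: that would also abstract the occurrence inside σ j
      by-prev : ∀ r → prevIn D j bs ≡ r → j ≤ π (σ j)
      by-prev nothing prev =
        subst (λ s → j ≤ π s) (sym (σ-first j∈B prev)) (T-bounded⇒≤ j≤m ℕ.≤-refl T-below-j-absent)
        where
        T-below-j-absent : ∀ {x} → x ∈ₗ T → x < j → π x ≤ π M
        T-below-j-absent x∈T x<j = contradiction
          (prevIn-nothing bs-increasing (inB⇒∈bs j∈B) prev (inB⇒∈bs (∈T⇒inB x∈T))) (ℕ.<⇒≱ x<j)
      by-prev (just x) prev =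
        let x∈bs , x<j , below-j-≤x = prevIn-just bs-increasing prev
            x∈T = ∈bs∧<m⇒∈T x∈bs (ℕ.<-≤-trans x<j j≤m)
        in subst (λ s → j ≤ π s) (sym (σ-prev j∈B prev)) (T-bounded⇒≤ j≤m (ℕ.<⇒≤ (πM<πT x∈T)) λ y∈T y<j →
             greedyT-monotone m allFin-increasing y∈T x∈T (below-j-≤x (inB⇒∈bs (∈T⇒inB y∈T)) y<j))

    rhoColour-two⇔-outside : ∀ {j} → isB j ≡ false →
                             rhoColour D C m M j ≡ two ⇔ (j ≡ m ⊎ colour D j ≡ two)
    rhoColour-two⇔-outside j∉B = mk⇔
      (inj₂ ∘ trans (sym (rhoColour-outside j∉B)))
      λ { (inj₁ refl)  → contradiction (trans (sym j∉B) (∈C⇒inB m∈C)) λ ()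
        ; (inj₂ c≡two) → trans (rhoColour-outside j∉B) c≡two }

    rhoColour-two⇔-upTo-m : ∀ {j} → isB j ≡ true → j ≤ m →
                            rhoColour D C m M j ≡ two ⇔ (j ≡ m ⊎ colour D j ≡ two)
    rhoColour-two⇔-upTo-m {j} j∈B j≤m =
      mk⇔ (λ _ → j≡m⊎two) (λ _ → rhoColour-weakExcedance j∈B (upTo-m⇒j≤πσj j∈B j≤m))
      where
      j≡m⊎two : j ≡ m ⊎ colour D j ≡ two
      j≡m⊎two with inB⇒∈C⊎T j∈B
      ... | inj₁ j∈C = inj₁ (≤-antisym j≤m (m≤C j∈C))
      ... | inj₂ j∈T = inj₂ (T-two j∈T)

    module _ (unblocked : ∀ j → j ∈ C → Unblocked D j) where

      above-m⇒one : ∀ {j} → isB j ≡ true → m < j → colour D j ≡ one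
      above-m⇒one j∈B m<j = proj₁ (unblocked _ (∈bs∧≥m⇒∈C (inB⇒∈bs j∈B) (ℕ.<⇒≤ m<j)))

      above-m⇒πσj<j : ∀ {j} → isB j ≡ true → m < j → π (σ j) < j
      above-m⇒πσj<j {j} j∈B m<j = by-prev (prevIn D j bs) refl
        where
        m∈bs : m ∈ₗ bs
        m∈bs = inB⇒∈bs (∈C⇒inB m∈C)
        by-prev : ∀ r → prevIn D j bs ≡ r → π (σ j) < j
        by-prev nothing prev =
          contradiction (prevIn-nothing bs-increasing (inB⇒∈bs j∈B) prev m∈bs) (ℕ.<⇒≱ m<j)
        by-prev (just x) prev =
          let x∈bs , x<j , below-j-≤x = prevIn-just bs-increasing prev
              x∈C = ∈bs∧≥m⇒∈C x∈bs (below-j-≤x m∈bs m<j)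
              j-one = above-m⇒one j∈B m<j
              πx<πj = proj₂ (unblocked x x∈C) j x<j j-one
          in subst (λ s → π s < j) (sym (σ-prev j∈B prev)) (ℕ.<-≤-trans πx<πj (colour-one⇒π≤ j-one))

      rhoColour-two⇔-above-m : ∀ {j} → isB j ≡ true → m < j →
                               rhoColour D C m M j ≡ two ⇔ (j ≡ m ⊎ colour D j ≡ two)
      rhoColour-two⇔-above-m j∈B m<j = mk⇔
        (λ ρ≡two → contradiction (trans (sym (rhoColour-descent (above-m⇒πσj<j j∈B m<j))) ρ≡two) one≢two)
        λ { (inj₁ refl)  → contradiction m<j (ℕ.<-irrefl refl)
          ; (inj₂ c≡two) → contradiction (trans (sym (above-m⇒one j∈B m<j)) c≡two) one≢two }

corollary5p12 : ∀ {n : ℕ} (D : DecoratedPerm n) (C : Subset n) (m M : Fin n)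
    → firstIn C ≡ just m
    → lastIn C ≡ just M
    → (∀ j → j ∈ C → Unblocked D j)
    → ∀ j → (rhoColour D C m M j ≡ two ⇔ (j ≡ m ⊎ colour D j ≡ two))
corollary5p12 D C m M m-first M-last unblocked j = by-region (inB D C m M j) refl (m <? j)
  where
  by-region : ∀ b → inB D C m M j ≡ b → Dec (m < j) →
              rhoColour D C m M j ≡ two ⇔ (j ≡ m ⊎ colour D j ≡ two)
  by-region false j∉B _         = rhoColour-two⇔-outside D C m-first M-last j∉B
  by-region true  j∈B (no m≮j)  = rhoColour-two⇔-upTo-m D C m-first M-last j∈B (ℕ.≮⇒≥ m≮j)
  by-region true  j∈B (yes m<j) = rhoColour-two⇔-above-m D C m-first M-last unblocked j∈B m<j
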